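{- Let $J$ be an instance of TAP-SM with the master list of schools $s_1,s_2,\dots,s_m$. Then $J$ admits a unique stable matching, which may be found by Algorithm Dual Serial Dictatorship.
   Context: TAP (the Teachers Assignment Problem): an instance consists of applicants, schools and subjects. Each applicant $a$ has a type ${\mathbf p}(a)=\{p_1,p_2\}$ of two distinct subjects and strictly ranks her acceptable schools $S(a)$. Each school $s$ has a partial capacity $c_p(s)$ for each subject $p$ and strictly ranks its applicants. A matching assigns each applicant to at most one acceptable school so that for each school $s$ and subject $p$ the number $|{\cal M}_p(s)|$ of assigned applicants whose type contains $p$ is at most $c_p(s)$. A pair $(a,s)$, $s\in S(a)$, blocks ${\cal M}$ if $a$ is unassigned or prefers $s$ to ${\cal M}(a)$ and: (i) $s$ is undersubscribed ($|{\cal M}_p(s)|<c_p(s)$) in both $p_1,p_2$; or (ii) $s$ is undersubscribed in $p_i$ and prefers $a$ to some applicant in ${\cal M}_{p_{3-i}}(s)$; or (iii) $s$ prefers $a$ to some assigned applicant of type exactly $\{p_1,p_2\}$; or (iv) $s$ prefers $a$ to two different applicants $a_1\in{\cal M}_{p_1}(s)$, $a_2\in{\cal M}_{p_2}(s)$. Stable means no blocking pair. TAP-SM is TAP in which every applicant's preference list is derived from a single common master list of schools. Algorithm Dual Serial Dictatorship: start with ${\cal M}=\emptyset$; for $j=1,\dots,m$ in master-list order, go through $s_j$'s preference list $a_{i_1},\dots,a_{i_\ell}$ in order and add $(a_{i_r},s_j)$ to ${\cal M}$ whenever $a_{i_r}$ is unassigned and $s_j$ has enough capacity for $a_{i_r}$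 (i.e., if $a_{i_r}$ has type $\{p,r\}$, $|{\cal M}_p(s_j)|<c_p(s_j)$ and $|{\cal M}_r(s_j)|<c_r(s_j)$). -}

module Defs where

open import Data.Nat using (ℕ; _≤_; _<_)
open import Data.Fin using (Fin; _≟_) renaming (_<_ to _<ᶠ_)
open import Data.Fin.Properties using () renaming (_≟_ to _≟ᶠ_)
open import Data.Maybe using (Maybe; just; nothing)
open import Data.Maybe.Properties using () renaming (≡-dec to ≡-decᴹ)
open import Data.List using (List; []; _∷_; filter; length; foldl; allFin)
open import Data.List.Membership.Propositional using (_∈_)
open import Data.List.Relation.Unary.Unique.Propositional using (Unique)
open import Data.Product using (Σ; ∃; _×_; _,_)
open import Data.Sum using (_⊎_)
open import Relation.Nullary using (¬_; Dec; yes; no)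
open import Relation.Nullary.Decidable using (_×-dec_; _⊎-dec_)
open import Relation.Binary.PropositionalEquality using (_≡_; _≢_)

-- Instances of TAP-SM.
-- Applicants : Fin n, schools : Fin m, subjects : Fin k.
-- The master list of schools is s_1, ..., s_m, i.e. the natural order
-- of Fin m (a smaller index is better).

record SubjType (k : ℕ) : Set where
  constructor ⟨_,_⟩∶_
  field
    p₁ : Fin k
    p₂ : Fin k
    distinct : p₁ ≢ p₂
open SubjType public

record Instance (n m k : ℕ) : Set where
  field
    type     : Fin n → SubjType k
    -- school s's strict preference list over its acceptable applicants
    prefList : Fin m → List (Fin n)
    prefUniq : ∀ s → Unique (prefList s)
    cap      : Fin m → Fin k → ℕ
open Instance public

module _ {n m k : ℕ} (I : Instance n m k) where

  Acceptable : Fin n → Fin m → Set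
  Acceptable a s = a ∈ prefList I s

  _≺ₐ_ : Fin m → Fin m → Set
  s ≺ₐ s' = s <ᶠ s'

data Before {A : Set} : List A → A → A → Set where
  here  : ∀ {a b xs} → b ∈ xs → Before (a ∷ xs) a b
  there : ∀ {x a b xs} → Before xs a b → Before (x ∷ xs) a b

module _ {n m k : ℕ} (I : Instance n m k) where

  SPrefers : Fin m → Fin n → Fin n → Set
  SPrefers s a b = Before (prefList I s) a b

  Assignment : Set
  Assignment = Fin n → Maybe (Fin m)

  HasSubj : SubjType k → Fin k → Set
  HasSubj t p = (p ≡ p₁ t) ⊎ (p ≡ p₂ t)

  hasSubj? : (t : SubjType k) (p : Fin k) → Dec (HasSubj t p)
  hasSubj? t p = (p ≟ᶠ p₁ t) ⊎-dec (p ≟ᶠ p₂ t)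

  InMp : Assignment → Fin m → Fin k → Fin n → Set
  InMp M s p a = (M a ≡ just s) × HasSubj (type I a) p

  inMp? : (M : Assignment) (s : Fin m) (p : Fin k) (a : Fin n) → Dec (InMp M s p a)
  inMp? M s p a = ≡-decᴹ _≟ᶠ_ (M a) (just s) ×-dec hasSubj? (type I a) p

  Mp : Assignment → Fin m → Fin k → List (Fin n)
  Mp M s p = filter (inMp? M s p) (allFin n)

  card : Assignment → Fin m → Fin k → ℕ
  card M s p = length (Mp M s p)

  IsMatching : Assignment → Set
  IsMatching M =
    (∀ a s → M a ≡ just s → Acceptable I a s) ×
    (∀ s p → card M s p ≤ cap I s p)

  Under : Assignment → Fin m → Fin k → Set
  Under M s p = card M s p < cap I s p

  SameType : SubjType k → SubjType k → Set
  SameType t u = ((p₁ t ≡ p₁ u) × (p₂ t ≡ p₂ u)) ⊎ ((p₁ t ≡ p₂ u) × (p₂ t ≡ p₁ u))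

  WantsSchool : Assignment → Fin n → Fin m → Set
  WantsSchool M a s = (M a ≡ nothing) ⊎ (∃ λ s' → (M a ≡ just s') × (_≺ₐ_ I s s'))

  BlockingPair : Assignment → Fin n → Fin m → Set
  BlockingPair M a s =
    Acceptable I a s × WantsSchool M a s ×
    (
      (Under M s q₁ × Under M s q₂)
    ⊎
      (Under M s q₁ × ∃ λ a' → InMp M s q₂ a' × SPrefers s a a')
    ⊎
      (Under M s q₂ × ∃ λ a' → InMp M s q₁ a' × SPrefers s a a')
    ⊎
      (∃ λ a' → (M a' ≡ just s) × SameType (type I a') (type I a) × SPrefers s a a')
    ⊎
      (∃ λ a₁ → ∃ λ a₂ → (a₁ ≢ a₂) × InMp M s q₁ a₁ × InMp M s q₂ a₂
                        × SPrefers s a a₁ × SPrefers s a a₂))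
    where
      q₁ = p₁ (type I a)
      q₂ = p₂ (type I a)

  Stable : Assignment → Set
  Stable M = IsMatching M × (∀ a s → ¬ BlockingPair M a s)

  empty : Assignment
  empty _ = nothing

  assign : Assignment → Fin n → Fin m → Assignment
  assign M a s a' with a' ≟ᶠ a
  ... | yes _ = just s
  ... | no  _ = M a'

  canAdd? : (M : Assignment) (s : Fin m) (a : Fin n) →
            Dec ((M a ≡ nothing) × Under M s (p₁ (type I a)) × Under M s (p₂ (type I a)))
  canAdd? M s a =
    ≡-decᴹ _≟ᶠ_ (M a) nothing ×-dec
    (Data.Nat._<?_ (card M s (p₁ (type I a))) (cap I s (p₁ (type I a))) ×-dec
     Data.Nat._<?_ (card M s (p₂ (type I a))) (cap I s (p₂ (type I a))))

  processSchool : Fin m → List (Fin n) → Assignment → Assignment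
  processSchool s [] M = M
  processSchool s (a ∷ as) M with canAdd? M s a
  ... | yes _ = processSchool s as (assign M a s)
  ... | no  _ = processSchool s as M

  dualSerialDictatorship : Assignment
  dualSerialDictatorship =
    foldl (λ M s → processSchool s (prefList I s) M) empty (allFin m)

-- Dual Serial Dictatorship visits the schools in master-list order, and every applicant
-- prefers earlier schools, so a school never loses an applicant it has taken. When school s
-- turns down an applicant a who is not already placed at an earlier school, it is because s
-- is full in a subject of a with applicants it all prefers to a; nothing later changes that,
-- so (a, s) cannot block. Conversely two stable matchings M and N coincide, school by school
-- in master-list order and, within a school s, applicant by applicant in s's order: if N places
-- a at s while M does not, then a prefers s to M(a) (earlier schools already agree), and in
-- each subject of a the school s either has room under M or, since N respects the capacity
-- and keeps everything M places at s above a, holds under M an applicant it ranks below a;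
-- so (a, s) blocks M.

module Submission where

open import Level using (0ℓ)
open import Data.Nat using (ℕ; suc; _≤_; _<_; z≤n; s≤s; _<?_)
open import Data.Nat.Properties using (≤-trans; m≤n⇒m≤1+n; <⇒≱; ≮⇒≥)
open import Data.Fin using (Fin; zero; suc) renaming (_<_ to _<ᶠ_)
open import Data.Fin.Properties using (<-cmp; <-irrefl; <-asym) renaming (_≟_ to _≟ᶠ_)
open import Data.Fin.Induction using (<-wellFounded)
open import Data.Maybe using (just; nothing)
open import Data.Maybe.Properties using () renaming (≡-dec to ≡-decᴹ)
open import Data.List using (List; []; _∷_; _++_; [_]; filter; length; foldl; allFin; map)
open import Data.List.Properties using (filter-≐; filter-none; foldl-++; ++-assoc; map-tabulate; map-++)
open import Data.List.Membership.Propositional using (_∈_; lose)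
open import Data.List.Membership.Propositional.Properties using (∈-allFin; ∈-++⁺ˡ; ∈-++⁺ʳ)
open import Data.List.Relation.Unary.Any using (Any; here; there; any?; satisfied)
open import Data.List.Relation.Unary.All as All using (All; []; _∷_)
import Data.List.Relation.Unary.All.Properties as AllP
open import Data.List.Relation.Unary.Unique.Propositional using (Unique; []; _∷_)
open import Data.List.Relation.Unary.Unique.Propositional.Properties using (allFin⁺)
open import Data.Product using (∃; ∃₂; _×_; _,_; proj₁; proj₂)
open import Data.Sum using (_⊎_; inj₁; inj₂; map₂)
open import Data.Empty using (⊥-elim)
open import Function using (_∘_)
open import Induction.WellFounded as WF using (WfRec)
open import Relation.Nullary using (¬_; yes; no)
open import Relation.Nullary.Decidable using (_×-dec_; ¬?)
open import Relation.Unary using (Pred; Decidable; _≐_; _⊆_)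
open import Relation.Unary.Properties using (≐-trans)
open import Relation.Binary using (tri<; tri≈; tri>)
open import Relation.Binary.PropositionalEquality using (_≡_; _≢_; refl; sym; trans; cong; cong-app; subst)
open import Defs

module _ {A : Set} {P Q : Pred A 0ℓ} (P? : Decidable P) (Q? : Decidable Q) where

  length-filter-mono : ∀ {xs} → All (λ x → P x → Q x) xs →
                       length (filter P? xs) ≤ length (filter Q? xs)
  length-filter-mono [] = z≤n
  length-filter-mono {x ∷ _} (P⇒Q ∷ h) with P? x | Q? x
  ... | yes _ | yes _ = s≤s (length-filter-mono h)
  ... | yes p | no ¬q = ⊥-elim (¬q (P⇒Q p))
  ... | no _  | yes _ = m≤n⇒m≤1+n (length-filter-mono h)
  ... | no _  | no _  = length-filter-mono h

  length-filter-< : ∀ {xs} → All (λ x → P x → Q x) xs → Any (λ x → Q x × ¬ P x) xs →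
                    length (filter P? xs) < length (filter Q? xs)
  length-filter-< {x ∷ _} (_ ∷ h) (here (q , ¬p)) with P? x | Q? x
  ... | yes p | _     = ⊥-elim (¬p p)
  ... | no _  | yes _ = s≤s (length-filter-mono h)
  ... | no _  | no ¬q = ⊥-elim (¬q q)
  length-filter-< {x ∷ _} (P⇒Q ∷ h) (there w) with P? x | Q? x
  ... | yes _ | yes _ = s≤s (length-filter-< h w)
  ... | yes p | no ¬q = ⊥-elim (¬q (P⇒Q p))
  ... | no _  | yes _ = m≤n⇒m≤1+n (length-filter-< h w)
  ... | no _  | no _  = length-filter-< h w

  filter-excess : ∀ xs → Any (λ x → Q x × ¬ P x) xs →
                  length (filter Q? xs) ≤ length (filter P? xs) →
                  Any (λ x → P x × ¬ Q x) xs
  filter-excess xs extraQ Q≤P with any? (λ x → P? x ×-dec ¬? (Q? x)) xs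
  ... | yes extraP = extraP
  ... | no ¬extraP = ⊥-elim (<⇒≱ (length-filter-< (All.tabulate P⇒Q) extraQ) Q≤P)
    where
    P⇒Q : ∀ {x} → x ∈ xs → P x → Q x
    P⇒Q {x} x∈xs p with Q? x
    ... | yes q = q
    ... | no ¬q = ⊥-elim (¬extraP (lose x∈xs (p , ¬q)))

length-filter-≤-suc : ∀ {A : Set} {P Q : Pred A 0ℓ} (P? : Decidable P) (Q? : Decidable Q)
                      {xs} b → Unique xs → All (λ x → x ≢ b → Q x → P x) xs →
                      length (filter Q? xs) ≤ suc (length (filter P? xs))
length-filter-≤-suc P? Q? b [] [] = z≤n
length-filter-≤-suc {P = P} {Q} P? Q? {x ∷ xs} b (x∉xs ∷ u) (Q⇒P ∷ h) with P? x | Q? x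
... | yes _ | yes _ = s≤s (length-filter-≤-suc P? Q? b u h)
... | yes _ | no _  = m≤n⇒m≤1+n (length-filter-≤-suc P? Q? b u h)
... | no _  | no _  = length-filter-≤-suc P? Q? b u h
... | no ¬p | yes q = s≤s (length-filter-mono Q? P? (All.tabulate Q⇒P-tail))
  where
  -- x is the only possible exception b, since P fails at x
  Q⇒P-tail : ∀ {y} → y ∈ xs → Q y → P y
  Q⇒P-tail y∈xs = All.lookup h y∈xs λ y≡b →
    ¬p (Q⇒P (λ x≡b → All.lookup x∉xs y∈xs (trans x≡b (sym y≡b))) q)

module _ {A : Set} where

  Before⇒∈ʳ : ∀ {xs : List A} {a b} → Before xs a b → b ∈ xs
  Before⇒∈ʳ (here b∈xs) = there b∈xs
  Before⇒∈ʳ (there p)   = there (Before⇒∈ʳ p)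

  Before-∷⇒∈ : ∀ {x} {xs : List A} {a b} → Before (x ∷ xs) a b → b ∈ xs
  Before-∷⇒∈ (here b∈xs) = b∈xs
  Before-∷⇒∈ (there p)   = Before⇒∈ʳ p

  Before-asym : ∀ {xs : List A} {a b} → Unique xs → Before xs a b → ¬ Before xs b a
  Before-asym (x∉xs ∷ _) (here _)   ba       = All.lookup x∉xs (Before-∷⇒∈ ba) refl
  Before-asym (x∉xs ∷ _) (there ab) (here _) = All.lookup x∉xs (Before⇒∈ʳ ab) refl
  Before-asym (_ ∷ u)    (there ab) (there ba) = Before-asym u ab ba

  Before-total : ∀ {xs : List A} {a b} → a ∈ xs → b ∈ xs → a ≢ b →
                 Before xs a b ⊎ Before xs b a
  Before-total (here refl) (here refl) a≢b = ⊥-elim (a≢b refl)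
  Before-total (here refl) (there b∈)  _   = inj₁ (here b∈)
  Before-total (there a∈)  (here refl) _   = inj₂ (here a∈)
  Before-total (there a∈)  (there b∈)  a≢b with Before-total a∈ b∈ a≢b
  ... | inj₁ ab = inj₁ (there ab)
  ... | inj₂ ba = inj₂ (there ba)

  Before-++ : ∀ (xs : List A) {ys a b} → a ∈ xs → b ∈ ys → Before (xs ++ ys) a b
  Before-++ (_ ∷ xs) (here refl) b∈ys = here (∈-++⁺ʳ xs b∈ys)
  Before-++ (_ ∷ xs) (there a∈)  b∈ys = there (Before-++ xs a∈ b∈ys)

  Before-induction : ∀ (R : A → Set) {xs} → Unique xs →
                     (∀ {a} → a ∈ xs → (∀ {a′} → Before xs a′ a → R a′) → R a) →
                     ∀ {a} → a ∈ xs → R a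
  Before-induction R {x ∷ xs} (x∉xs ∷ u) step = λ where
      (here refl)  → Rx
      (there a∈xs) → Before-induction R u step-tail a∈xs
    where
    Rx : R x
    Rx = step (here refl) λ before-x → ⊥-elim (All.lookup x∉xs (Before-∷⇒∈ before-x) refl)
    step-tail : ∀ {a} → a ∈ xs → (∀ {a′} → Before xs a′ a → R a′) → R a
    step-tail a∈xs ih = step (there a∈xs) λ where
      (here _)  → Rx
      (there b) → ih b

allFin-suc : ∀ m → allFin (suc m) ≡ zero ∷ map suc (allFin m)
allFin-suc m = cong (zero ∷_) (sym (map-tabulate (λ i → i) suc))

allFin-split : ∀ {m} (s : Fin m) → ∃₂ λ ys zs →
               allFin m ≡ ys ++ s ∷ zs × All (_<ᶠ s) ys × All (s <ᶠ_) zs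
allFin-split {suc m} zero =
  [] , map suc (allFin m) , allFin-suc m , [] , AllP.map⁺ (All.universal (λ _ → s≤s z≤n) _)
allFin-split {suc m} (suc s) with allFin-split s
... | ys , zs , split , ys<s , s<zs =
  zero ∷ map suc ys , map suc zs ,
  trans (allFin-suc m) (cong (zero ∷_) (trans (cong (map suc) split) (map-++ suc ys (s ∷ zs)))) ,
  s≤s z≤n ∷ AllP.map⁺ (All.map s≤s ys<s) , AllP.map⁺ (All.map s≤s s<zs)

module _ {n m k : ℕ} (I : Instance n m k) where

  assign-≡ : ∀ (M : Assignment I) a s → assign I M a s a ≡ just s
  assign-≡ M a s with a ≟ᶠ a
  ... | yes _   = refl
  ... | no a≢a = ⊥-elim (a≢a refl)

  assign-≢ : ∀ (M : Assignment I) {a b} s → a ≢ b → assign I M b s a ≡ M a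
  assign-≢ M {a} {b} s a≢b with a ≟ᶠ b
  ... | yes a≡b = ⊥-elim (a≢b a≡b)
  ... | no _    = refl

  processSchool-keeps : ∀ s as {M : Assignment I} {a t} → M a ≡ just t →
                        processSchool I s as M a ≡ just t
  processSchool-keeps s []       Ma = Ma
  processSchool-keeps s (b ∷ as) {M} {a} Ma with canAdd? I M s b
  ... | no _            = processSchool-keeps s as Ma
  ... | yes (b-free , _) = processSchool-keeps s as (trans (assign-≢ M s a≢b) Ma)
    where
    a≢b : a ≢ b
    a≢b refl with () ← trans (sym Ma) b-free

  processSchool-source : ∀ s as {M : Assignment I} {a t} → processSchool I s as M a ≡ just t →
                         M a ≡ just t ⊎ (t ≡ s × a ∈ as)
  processSchool-source s []       e = inj₁ e
  processSchool-source s (b ∷ as) {M} {a} e with canAdd? I M s b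
  ... | no _ with processSchool-source s as e
  ...   | inj₁ Ma           = inj₁ Ma
  ...   | inj₂ (t≡s , a∈as) = inj₂ (t≡s , there a∈as)
  processSchool-source s (b ∷ as) {M} {a} e | yes _ with processSchool-source s as e
  ...   | inj₂ (t≡s , a∈as) = inj₂ (t≡s , there a∈as)
  ...   | inj₁ e′ with a ≟ᶠ b
  ...     | no _     = inj₁ e′
  ...     | yes refl with refl ← e′ = inj₂ (refl , here refl)

  round : Assignment I → Fin m → Assignment I
  round M s = processSchool I s (prefList I s) M

  rounds-keep : ∀ L {M : Assignment I} {a t} → M a ≡ just t → foldl round M L a ≡ just t
  rounds-keep []      Ma = Ma
  rounds-keep (s ∷ L) Ma = rounds-keep L (processSchool-keeps s (prefList I s) Ma)

  rounds-source : ∀ L {M : Assignment I} {a t} → foldl round M L a ≡ just t →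
                  M a ≡ just t ⊎ (t ∈ L × Acceptable I a t)
  rounds-source []      e = inj₁ e
  rounds-source (s ∷ L) e with rounds-source L e
  ... | inj₂ (t∈L , acc) = inj₂ (there t∈L , acc)
  ... | inj₁ e′ with processSchool-source s (prefList I s) e′
  ...   | inj₁ Ma         = inj₁ Ma
  ...   | inj₂ (refl , acc) = inj₂ (here refl , acc)

  card-cong : ∀ {M M′ : Assignment I} s p → InMp I M s p ≐ InMp I M′ s p →
              card I M s p ≡ card I M′ s p
  card-cong {M} {M′} s p same =
    cong length (filter-≐ (inMp? I M s p) (inMp? I M′ s p) same (allFin n))

  Under-cong : ∀ {M M′ : Assignment I} s p → InMp I M s p ≐ InMp I M′ s p →
               Under I M s p → Under I M′ s p
  Under-cong s p same = subst (_< cap I s p) (card-cong s p same)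

  card-assign-≤ : ∀ (M : Assignment I) b s p →
                  card I (assign I M b s) s p ≤ suc (card I M s p)
  card-assign-≤ M b s p =
    length-filter-≤-suc (inMp? I M s p) (inMp? I (assign I M b s) s p) b (allFin⁺ n)
      (All.universal (λ _ a≢b (e , h) → trans (sym (assign-≢ M s a≢b)) e , h) (allFin n))

  InMp-assign-other : ∀ (M : Assignment I) {b} s {p} → ¬ HasSubj I (type I b) p →
                      InMp I (assign I M b s) s p ≐ InMp I M s p
  InMp-assign-other M {b} s {p} ¬hp = to , from
    where
    to : InMp I (assign I M b s) s p ⊆ InMp I M s p
    to {a} (e , h) with a ≟ᶠ b
    ... | yes refl = ⊥-elim (¬hp h)
    ... | no _     = e , h
    from : InMp I M s p ⊆ InMp I (assign I M b s) s p
    from {a} (e , h) with a ≟ᶠ b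
    ... | yes refl = ⊥-elim (¬hp h)
    ... | no _     = e , h

  processSchool-within-cap : ∀ s as {M : Assignment I} →
                             (∀ p → card I M s p ≤ cap I s p) →
                             ∀ p → card I (processSchool I s as M) s p ≤ cap I s p
  processSchool-within-cap s []       within = within
  processSchool-within-cap s (b ∷ as) {M} within with canAdd? I M s b
  ... | no _                  = processSchool-within-cap s as within
  ... | yes (_ , room₁ , room₂) = processSchool-within-cap s as within′
    where
    within′ : ∀ p → card I (assign I M b s) s p ≤ cap I s p
    within′ p with hasSubj? I (type I b) p
    ... | yes (inj₁ refl) = ≤-trans (card-assign-≤ M b s p) room₁
    ... | yes (inj₂ refl) = ≤-trans (card-assign-≤ M b s p) room₂
    ... | no ¬hp = subst (_≤ cap I s p) (sym (card-cong s p (InMp-assign-other M s ¬hp))) (within p)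

  processSchool-full : ∀ s as {M : Assignment I} {p} → ¬ Under I M s p →
                       InMp I (processSchool I s as M) s p ≐ InMp I M s p
  processSchool-full s []       full = (λ x → x) , (λ x → x)
  processSchool-full s (b ∷ as) {M} {p} full with canAdd? I M s b
  ... | no _ = processSchool-full s as full
  ... | yes (_ , room₁ , room₂) with hasSubj? I (type I b) p
  ...   | yes (inj₁ refl) = ⊥-elim (full room₁)
  ...   | yes (inj₂ refl) = ⊥-elim (full room₂)
  ...   | no ¬hp = ≐-trans (processSchool-full s as (full ∘ Under-cong s p same)) same
    where
    same : InMp I (assign I M b s) s p ≐ InMp I M s p
    same = InMp-assign-other M s ¬hp

  -- The reason Dual Serial Dictatorship gives when s turns a down.
  FullFor : Assignment I → Fin m → Fin n → Set
  FullFor M s a = ∃ λ p → HasSubj I (type I a) p × ¬ Under I M s p ×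
                          (∀ {a′} → InMp I M s p a′ → SPrefers I s a′ a)

  FullFor-transfer : ∀ {M M′ : Assignment I} {s a} →
                     (∀ {p} → ¬ Under I M s p → InMp I M′ s p ≐ InMp I M s p) →
                     FullFor M s a → FullFor M′ s a
  FullFor-transfer same (p , hp , full , pref) =
    p , hp , full ∘ Under-cong _ p (same full) , pref ∘ proj₁ (same full)

  placed-earlier-preferred : ∀ {s pre as a} {M : Assignment I} →
                             prefList I s ≡ pre ++ a ∷ as →
                             (∀ {a′} → M a′ ≡ just s → a′ ∈ pre) →
                             ∀ {p a′} → InMp I M s p a′ → SPrefers I s a′ a
  placed-earlier-preferred {pre = pre} {a = a} split in-pre (e , _) =
    subst (λ l → Before l _ a) (sym split) (Before-++ pre (in-pre e) (here refl))

  assign-placed-in-pre : ∀ {M : Assignment I} {s pre b} → (∀ {a′} → M a′ ≡ just s → a′ ∈ pre) →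
                         ∀ {a′} → assign I M b s a′ ≡ just s → a′ ∈ pre ++ [ b ]
  assign-placed-in-pre {pre = pre} {b} in-pre {a′} e with a′ ≟ᶠ b
  ... | yes refl = ∈-++⁺ʳ pre (here refl)
  ... | no _     = ∈-++⁺ˡ (in-pre e)

  processSchool-rejects : ∀ s pre as {M : Assignment I} {a} →
                          prefList I s ≡ pre ++ a ∷ as →
                          (∀ {a′} → M a′ ≡ just s → a′ ∈ pre) →
                          ¬ (M a ≡ nothing × Under I M s (p₁ (type I a)) × Under I M s (p₂ (type I a))) →
                          (∃ λ t → M a ≡ just t × processSchool I s as M a ≡ just t) ⊎
                          FullFor (processSchool I s as M) s a
  processSchool-rejects s pre as {M} {a} split in-pre cannot with M a in Ma
  ... | just t  = inj₁ (t , refl , processSchool-keeps s as Ma)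
  ... | nothing with card I M s (p₁ (type I a)) <? cap I s (p₁ (type I a))
  ...   | no full₁  = inj₂ (FullFor-transfer (processSchool-full s as)
                             (_ , inj₁ refl , full₁ , placed-earlier-preferred split in-pre))
  ...   | yes room₁ = inj₂ (FullFor-transfer (processSchool-full s as)
                             (_ , inj₂ refl , (λ room₂ → cannot (refl , room₁ , room₂)) ,
                              placed-earlier-preferred split in-pre))

  processSchool-outcome : ∀ s pre as {M : Assignment I} → prefList I s ≡ pre ++ as →
                          (∀ {a′} → M a′ ≡ just s → a′ ∈ pre) → ∀ {a} → a ∈ as →
                          (∃ λ t → M a ≡ just t × processSchool I s as M a ≡ just t) ⊎
                          processSchool I s as M a ≡ just s ⊎
                          FullFor (processSchool I s as M) s a
  processSchool-outcome s pre (b ∷ as) {M} split in-pre {a} a∈ with canAdd? I M s b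
  ... | no cannot with a∈
  ...   | here refl = map₂ inj₂ (processSchool-rejects s pre as split in-pre cannot)
  ...   | there a∈as =
          processSchool-outcome s (pre ++ [ b ]) as (trans split (sym (++-assoc pre [ b ] as)))
            (∈-++⁺ˡ ∘ in-pre) a∈as
  processSchool-outcome s pre (b ∷ as) {M} split in-pre {a} a∈ | yes _ with a ≟ᶠ b | a∈
  ... | yes refl | _ = inj₂ (inj₁ (processSchool-keeps s as (assign-≡ M a s)))
  ... | no a≢b | here a≡b = ⊥-elim (a≢b a≡b)
  ... | no a≢b | there a∈as
      with processSchool-outcome s (pre ++ [ b ]) as (trans split (sym (++-assoc pre [ b ] as)))
             (assign-placed-in-pre in-pre) a∈as
  ...   | inj₁ (t , e₀ , e) = inj₁ (t , trans (sym (assign-≢ M s a≢b)) e₀ , e)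
  ...   | inj₂ outcome      = inj₂ outcome

  DSD : Assignment I
  DSD = dualSerialDictatorship I

  DSD-acceptable : ∀ {a t} → DSD a ≡ just t → Acceptable I a t
  DSD-acceptable e with rounds-source (allFin m) e
  ... | inj₂ (_ , acc) = acc

  module AtSchool (s : Fin m) {ys zs : List (Fin m)} (allFin≡ : allFin m ≡ ys ++ s ∷ zs)
               (ys<s : All (_<ᶠ s) ys) (s<zs : All (s <ᶠ_) zs) where

    before after : Assignment I
    before = foldl round (empty I) ys
    after  = round before s

    DSD≡ : DSD ≡ foldl round after zs
    DSD≡ = trans (cong (foldl round (empty I)) allFin≡) (foldl-++ round (empty I) ys (s ∷ zs))

    before-earlier : ∀ {a t} → before a ≡ just t → t <ᶠ s
    before-earlier e with rounds-source ys e
    ... | inj₂ (t∈ys , _) = All.lookup ys<s t∈ys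

    before-vacant : ∀ {a} → before a ≢ just s
    before-vacant e = <-irrefl refl (before-earlier e)

    after⇒DSD : ∀ {a t} → after a ≡ just t → DSD a ≡ just t
    after⇒DSD {a} e = trans (cong-app DSD≡ a) (rounds-keep zs e)

    DSD⇒after : ∀ {a} → DSD a ≡ just s → after a ≡ just s
    DSD⇒after {a} e with rounds-source zs (trans (sym (cong-app DSD≡ a)) e)
    ... | inj₁ e′         = e′
    ... | inj₂ (s∈zs , _) = ⊥-elim (<-irrefl refl (All.lookup s<zs s∈zs))

    InMp-DSD : ∀ p → InMp I DSD s p ≐ InMp I after s p
    InMp-DSD p = (λ (e , h) → DSD⇒after e , h) , (λ (e , h) → after⇒DSD e , h)

    within-cap : ∀ p → card I DSD s p ≤ cap I s p
    within-cap p = subst (_≤ cap I s p) (sym (card-cong s p (InMp-DSD p)))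
                     (processSchool-within-cap s (prefList I s) before-within p)
      where
      before-within : ∀ p → card I before s p ≤ cap I s p
      before-within p =
        subst (_≤ cap I s p)
          (sym (cong length (filter-none (inMp? I before s p)
                  (All.universal (λ _ (e , _) → before-vacant e) (allFin n)))))
          z≤n

    outcome : ∀ {a} → Acceptable I a s →
              (∃ λ t → t <ᶠ s × DSD a ≡ just t) ⊎ DSD a ≡ just s ⊎ FullFor DSD s a
    outcome a∈ with processSchool-outcome s [] (prefList I s) refl (⊥-elim ∘ before-vacant) a∈
    ... | inj₁ (t , e₀ , e)  = inj₁ (t , before-earlier e₀ , after⇒DSD e)
    ... | inj₂ (inj₁ e)     = inj₂ (inj₁ (after⇒DSD e))
    ... | inj₂ (inj₂ full)  = inj₂ (inj₂ (FullFor-transfer (λ {p} _ → InMp-DSD p) full))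

  DSD-within-cap : ∀ s p → card I DSD s p ≤ cap I s p
  DSD-within-cap s with allFin-split s
  ... | _ , _ , split , ys<s , s<zs = AtSchool.within-cap s split ys<s s<zs

  DSD-outcome : ∀ {a s} → Acceptable I a s →
                (∃ λ t → t <ᶠ s × DSD a ≡ just t) ⊎ DSD a ≡ just s ⊎ FullFor DSD s a
  DSD-outcome {s = s} with allFin-split s
  ... | _ , _ , split , ys<s , s<zs = AtSchool.outcome s split ys<s s<zs

  HasSubj-SameType : ∀ (t u : SubjType k) {p} → SameType I t u → HasSubj I u p → HasSubj I t p
  HasSubj-SameType _ _ (inj₁ (e₁ , _)) (inj₁ h) = inj₁ (trans h (sym e₁))
  HasSubj-SameType _ _ (inj₁ (_ , e₂)) (inj₂ h) = inj₂ (trans h (sym e₂))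
  HasSubj-SameType _ _ (inj₂ (_ , e₂)) (inj₁ h) = inj₂ (trans h (sym e₂))
  HasSubj-SameType _ _ (inj₂ (e₁ , _)) (inj₂ h) = inj₁ (trans h (sym e₁))

  HasSubj⇒SameType : ∀ (t u : SubjType k) → HasSubj I t (p₁ u) → HasSubj I t (p₂ u) → SameType I t u
  HasSubj⇒SameType _ u (inj₁ h₁) (inj₁ h₂) = ⊥-elim (distinct u (trans h₁ (sym h₂)))
  HasSubj⇒SameType _ _ (inj₁ h₁) (inj₂ h₂) = inj₁ (sym h₁ , sym h₂)
  HasSubj⇒SameType _ _ (inj₂ h₁) (inj₁ h₂) = inj₂ (sym h₂ , sym h₁)
  HasSubj⇒SameType _ u (inj₂ h₁) (inj₂ h₂) = ⊥-elim (distinct u (trans h₁ (sym h₂)))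

  -- The four blocking conditions say exactly that s can take a in both subjects of a,
  -- through a free slot or by dropping an applicant it ranks below a.
  Admits : Assignment I → Fin m → Fin n → Fin k → Set
  Admits M s a q = Under I M s q ⊎ ∃ λ a′ → InMp I M s q a′ × SPrefers I s a a′

  BlockingPair⇒Admits : ∀ {M : Assignment I} {a s} → BlockingPair I M a s →
                        Admits M s a (p₁ (type I a)) × Admits M s a (p₂ (type I a))
  BlockingPair⇒Admits (_ , _ , inj₁ (room₁ , room₂))        = inj₁ room₁ , inj₁ room₂
  BlockingPair⇒Admits (_ , _ , inj₂ (inj₁ (room₁ , worse₂))) = inj₁ room₁ , inj₂ worse₂
  BlockingPair⇒Admits (_ , _ , inj₂ (inj₂ (inj₁ (room₂ , worse₁)))) = inj₂ worse₁ , inj₁ room₂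
  BlockingPair⇒Admits (_ , _ , inj₂ (inj₂ (inj₂ (inj₁ (a′ , e , same , a≺a′))))) =
    inj₂ (a′ , (e , HasSubj-SameType (type I a′) (type I _) same (inj₁ refl)) , a≺a′) ,
    inj₂ (a′ , (e , HasSubj-SameType (type I a′) (type I _) same (inj₂ refl)) , a≺a′)
  BlockingPair⇒Admits (_ , _ , inj₂ (inj₂ (inj₂ (inj₂ (a₁ , a₂ , _ , x₁ , x₂ , a≺a₁ , a≺a₂))))) =
    inj₂ (a₁ , x₁ , a≺a₁) , inj₂ (a₂ , x₂ , a≺a₂)

  Admits⇒BlockingPair : ∀ {M : Assignment I} {a s} → Acceptable I a s → WantsSchool I M a s →
                        Admits M s a (p₁ (type I a)) → Admits M s a (p₂ (type I a)) →
                        BlockingPair I M a s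
  Admits⇒BlockingPair acc wants (inj₁ room₁) (inj₁ room₂) = acc , wants , inj₁ (room₁ , room₂)
  Admits⇒BlockingPair acc wants (inj₁ room₁) (inj₂ worse₂) = acc , wants , inj₂ (inj₁ (room₁ , worse₂))
  Admits⇒BlockingPair acc wants (inj₂ worse₁) (inj₁ room₂) =
    acc , wants , inj₂ (inj₂ (inj₁ (room₂ , worse₁)))
  Admits⇒BlockingPair acc wants (inj₂ (a₁ , x₁ , a≺a₁)) (inj₂ (a₂ , x₂ , a≺a₂)) with a₁ ≟ᶠ a₂
  ... | yes refl = acc , wants ,
        inj₂ (inj₂ (inj₂ (inj₁ (a₁ , proj₁ x₁ , same , a≺a₁))))
    where
    same = HasSubj⇒SameType (type I a₁) (type I _) (proj₂ x₁) (proj₂ x₂)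
  ... | no a₁≢a₂ = acc , wants ,
        inj₂ (inj₂ (inj₂ (inj₂ (a₁ , a₂ , a₁≢a₂ , x₁ , x₂ , a≺a₁ , a≺a₂))))

  FullFor⇒¬Admits : ∀ {M : Assignment I} {s a} ((p , _) : FullFor M s a) → ¬ Admits M s a p
  FullFor⇒¬Admits (_ , _ , full , _)    (inj₁ room)            = full room
  FullFor⇒¬Admits {s = s} (_ , _ , _ , pref) (inj₂ (_ , x , a≺a′)) =
    Before-asym (prefUniq I s) (pref x) a≺a′

  settled-¬WantsSchool : ∀ {M : Assignment I} {a s t} → M a ≡ just t → ¬ s <ᶠ t →
                         ¬ WantsSchool I M a s
  settled-¬WantsSchool Ma s≮t (inj₁ e) with () ← trans (sym Ma) e
  settled-¬WantsSchool Ma s≮t (inj₂ (_ , e , s<t)) with refl ← trans (sym Ma) e = s≮t s<t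

  DSD-stable : Stable I DSD
  DSD-stable = ((λ _ _ → DSD-acceptable) , DSD-within-cap) , unblocked
    where
    unblocked : ∀ a s → ¬ BlockingPair I DSD a s
    unblocked a s blocking@(acc , wants , _) with DSD-outcome acc
    ... | inj₁ (t , t<s , e) = settled-¬WantsSchool {M = DSD} e (<-asym t<s) wants
    ... | inj₂ (inj₁ e)     = settled-¬WantsSchool {M = DSD} e (<-irrefl refl) wants
    ... | inj₂ (inj₂ full@(_ , inj₁ refl , _)) =
          FullFor⇒¬Admits {M = DSD} full (proj₁ (BlockingPair⇒Admits blocking))
    ... | inj₂ (inj₂ full@(_ , inj₂ refl , _)) =
          FullFor⇒¬Admits {M = DSD} full (proj₂ (BlockingPair⇒Admits blocking))

  displaced-WantsSchool : ∀ {M N : Assignment I} {a s} →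
                          (∀ {s′} → s′ <ᶠ s → M a ≡ just s′ → N a ≡ just s′) →
                          N a ≡ just s → M a ≢ just s → WantsSchool I M a s
  displaced-WantsSchool {M} {a = a} {s} agree-earlier Na ¬Ma with M a in Ma
  ... | nothing = inj₁ refl
  ... | just s′ with <-cmp s s′
  ...   | tri< s<s′ _ _ = inj₂ (s′ , refl , s<s′)
  ...   | tri≈ _ refl _ = ⊥-elim (¬Ma refl)
  ...   | tri> _ _ s′<s with refl ← trans (sym Na) (agree-earlier s′<s refl) =
          ⊥-elim (<-irrefl refl s′<s)

  -- Counting against N's capacity: if s is full in q under M, some q-applicant of M at s is
  -- not kept by N, and s cannot prefer it to a since N keeps all of those.
  displaced-Admits : ∀ {M N : Assignment I} {a s} → IsMatching I M → IsMatching I N →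
                     N a ≡ just s → M a ≢ just s →
                     (∀ {a′} → SPrefers I s a′ a → M a′ ≡ just s → N a′ ≡ just s) →
                     ∀ {q} → HasSubj I (type I a) q → Admits M s a q
  displaced-Admits {M} {N} {a} {s} (M-acc , _) (N-acc , N-cap) Na ¬Ma agree-above {q} hq
    with card I M s q <? cap I s q
  ... | yes room = inj₁ room
  ... | no full
      with satisfied (filter-excess (inMp? I M s q) (inMp? I N s q) (allFin n)
                        (lose (∈-allFin a) ((Na , hq) , ¬Ma ∘ proj₁))
                        (≤-trans (N-cap s q) (≮⇒≥ full)))
  ...   | x , (Mx , hx) , ¬Nx
      with Before-total (M-acc x s Mx) (N-acc a s Na) (λ { refl → ¬Ma Mx })
  ...     | inj₁ x≺a = ⊥-elim (¬Nx (agree-above x≺a Mx , hx))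
  ...     | inj₂ a≺x = inj₂ (x , (Mx , hx) , a≺x)

  stable-respects : ∀ {M N : Assignment I} {a s} → Stable I M → IsMatching I N →
                    (∀ {s′} → s′ <ᶠ s → ∀ {a′} → M a′ ≡ just s′ → N a′ ≡ just s′) →
                    (∀ {a′} → SPrefers I s a′ a → M a′ ≡ just s → N a′ ≡ just s) →
                    N a ≡ just s → M a ≡ just s
  stable-respects {M} {N} {a} {s} (M-matching , M-unblocked) N-matching
                  agree-earlier agree-above Na
    with ≡-decᴹ _≟ᶠ_ (M a) (just s)
  ... | yes Ma = Ma
  ... | no ¬Ma = ⊥-elim (M-unblocked a s
                   (Admits⇒BlockingPair (proj₁ N-matching a s Na)
                     (displaced-WantsSchool {M = M} {N} (λ s′<s → agree-earlier s′<s) Na ¬Ma)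
                     (admits (inj₁ refl)) (admits (inj₂ refl))))
    where
    admits : ∀ {q} → HasSubj I (type I a) q → Admits M s a q
    admits = displaced-Admits M-matching N-matching Na ¬Ma agree-above

  SameAt : Assignment I → Assignment I → Fin m → Set
  SameAt M N s = ∀ {a} → (M a ≡ just s → N a ≡ just s) × (N a ≡ just s → M a ≡ just s)

  stable-SameAt : ∀ {M N : Assignment I} → Stable I M → Stable I N → ∀ s → SameAt M N s
  stable-SameAt {M} {N} M-stable N-stable = WF.All.wfRec <-wellFounded 0ℓ (SameAt M N) same-at
    where
    same-at : ∀ s → WfRec _<ᶠ_ (SameAt M N) s → SameAt M N s
    same-at s same-earlier {a} =
      (λ Ma → proj₁ (along-prefList (proj₁ (proj₁ M-stable) a s Ma)) Ma) ,
      (λ Na → proj₂ (along-prefList (proj₁ (proj₁ N-stable) a s Na)) Na)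
      where
      along-prefList : ∀ {a} → a ∈ prefList I s →
                       (M a ≡ just s → N a ≡ just s) × (N a ≡ just s → M a ≡ just s)
      along-prefList = Before-induction _ (prefUniq I s) λ _ same-above →
        stable-respects N-stable (proj₁ M-stable)
          (λ s′<s → proj₂ (same-earlier s′<s)) (proj₂ ∘ same-above) ,
        stable-respects M-stable (proj₁ N-stable)
          (λ s′<s → proj₁ (same-earlier s′<s)) (proj₁ ∘ same-above)

  stable-unique : ∀ {M N : Assignment I} → Stable I M → Stable I N → ∀ a → M a ≡ N a
  stable-unique {M} {N} M-stable N-stable a with M a in Ma
  ... | just s  = sym (proj₁ (stable-SameAt M-stable N-stable s) Ma)
  ... | nothing with N a in Na
  ...   | nothing = refl
  ...   | just t with () ← trans (sym (proj₂ (stable-SameAt M-stable N-stable t) Na)) Ma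

theorem3 : {n m k : ℕ} (J : Instance n m k) →
           Stable J (dualSerialDictatorship J) ×
           (∀ (M : Assignment J) → Stable J M →
              ∀ (a : Fin n) → M a ≡ dualSerialDictatorship J a)
theorem3 J = DSD-stable J , λ M M-stable → stable-unique J M-stable (DSD-stable J)
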